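{- Promotion on $\mathrm{Inc}^q(\mathcal{Z}_4)$ is $2(q+1)$-mesic with respect to the total sum statistic.
   Context: $\mathcal{Z}_4$ is the zig-zag poset $x_1\lessdot x_2\gtrdot x_3\lessdot x_4$. $\mathrm{Inc}^q(\mathcal{Z}_4)$ is the set of increasing labelings $f:\mathcal{Z}_4\to[q]$ ($f(x)<f(y)$ whenever $x<y$). Promotion: replace labels $1$ by empty boxes; for $i=2,\dots,q$ slide boxes upward (a box at $x$ becomes $i$ if some $y\gtrdot x$ is labeled $i$, and that $y$ becomes a box); replace boxes by $q+1$ and subtract $1$ from every label. The total sum statistic is $\mathrm{Tot}(f)=\sum_x f(x)$. "$c$-mesic" means every promotion orbit has average total sum equal to $c$. -}

module Defs where

open import Data.Nat using (ℕ; zero; suc; _+_; _*_; _∸_; _<_; _≤_; _≡ᵇ_)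
open import Data.Fin using (Fin; zero; suc)
open import Data.Bool using (Bool; true; false; if_then_else_; _∧_; _∨_)
open import Data.Maybe using (Maybe; just; nothing)
open import Data.Vec using (Vec; lookup; tabulate; map; foldr)
open import Data.List using (List; foldl; upTo) renaming (map to mapL)
open import Relation.Binary.PropositionalEquality using (_≡_)
open import Data.Empty using (⊥)
open import Data.Product using (_×_)

-- The zig-zag poset Z₄ on Fin 4, with zero = x₁, 1 = x₂, 2 = x₃, 3 = x₄.
-- Cover relations:  x₁ ⋖ x₂ ,  x₃ ⋖ x₂ ,  x₃ ⋖ x₄.
_⋖_ : Fin 4 → Fin 4 → Bool
zero ⋖ suc zero = true
suc (suc zero) ⋖ suc zero = true
suc (suc zero) ⋖ suc (suc (suc zero)) = true
_ ⋖ _ = false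

-- Strict order of Z₄: x < y.  Since Z₄ has no chains of length > 2,
-- the strict order coincides with the cover relation.
_<Z_ : Fin 4 → Fin 4 → Set
x <Z y = x ⋖ y ≡ true

-- A labeling of Z₄ by natural numbers (value at x_{i+1} is entry i).
Labeling : Set
Labeling = Vec ℕ 4

record Inc (q : ℕ) (f : Labeling) : Set where
  field
    inRange    : ∀ x → 1 ≤ lookup f x × lookup f x ≤ q
    increasing : ∀ x y → x <Z y → lookup f x < lookup f y

Tot : Labeling → ℕ
Tot f = foldr (λ _ → ℕ) _+_ 0 f

-- Intermediate states of promotion: nothing = empty box.
State : Set
State = Vec (Maybe ℕ) 4

private
  isLabel : ℕ → Maybe ℕ → Bool
  isLabel i (just a) = a ≡ᵇ i
  isLabel i nothing  = false

  isBox : Maybe ℕ → Bool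
  isBox nothing  = true
  isBox (just _) = false

  anyFin : (Fin 4 → Bool) → Bool
  anyFin p = foldr (λ _ → Bool) _∨_ false (tabulate p)

-- One sliding step with label i: a box at x becomes i if some y ⋗ x is
-- labeled i, and every such y (i.e. an element labeled i covering a box)
-- becomes a box; all simultaneously.
slide : ℕ → State → State
slide i s = tabulate new
  where
    new : Fin 4 → Maybe ℕ
    new x with isBox (lookup s x)
    ... | true  = if anyFin (λ y → (x ⋖ y) ∧ isLabel i (lookup s y))
                    then just i else nothing
    ... | false = if isLabel i (lookup s x)
                      ∧ anyFin (λ z → (z ⋖ x) ∧ isBox (lookup s z))
                    then nothing else lookup s x

pro : ℕ → Labeling → Labeling
pro q f = map finish slid
  where
    start : State
    start = map (λ a → if a ≡ᵇ 1 then nothing else just a) f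
    slid : State
    slid = foldl (λ s i → slide i s) start (mapL (2 +_) (upTo (q ∸ 1)))
    finish : Maybe ℕ → ℕ
    finish nothing  = q          -- box ↦ q + 1, then subtract 1
    finish (just a) = a ∸ 1

iter : ℕ → (Labeling → Labeling) → Labeling → Labeling
iter zero    g f = f
iter (suc k) g f = g (iter k g f)

orbitSum : ℕ → ℕ → Labeling → ℕ
orbitSum q zero    f = 0
orbitSum q (suc n) f = orbitSum q n f + Tot (iter n (pro q) f)

IsOrbitSize : ℕ → Labeling → ℕ → Set
IsOrbitSize q f n =
  (0 < n) × (iter n (pro q) f ≡ f) × (∀ m → 0 < m → m < n → iter m (pro q) f ≡ f → ⊥)

Mesic : ℕ → ℕ → Set
Mesic q c = ∀ f → Inc q f → ∀ n → IsOrbitSize q f n → orbitSum q n f ≡ c * n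

-- Tot − 2(q+1) is a coboundary for promotion, so its sum over any orbit vanishes.
-- Match the elements of Z₄ into two pairs: {x₁,x₃} and {x₂,x₄} when f(x₃) ≤ f(x₁) and
-- f(x₄) ≤ f(x₂), and {x₂,x₃} and {x₄,x₁} otherwise. On an increasing labeling every pair
-- then carries labels u ≥ v; give it the potential u(q − u) + v(u − v) = u(q + v) − u² − v².
-- One promotion step carries the labels of each matched pair of f to those of a matched
-- pair of pro f in one of five ways,
--   (u, v) ↦ (u − 1, v − 1),  (u, 1) ↦ (q, u − 1),  (u, u) ↦ (q, u − 1),
--   (u, 1) ↦ (u − 1, u − 1),  (1, 1) ↦ (q, q),
-- and each of them changes the pair potential by exactly u + v − (q + 1). Hence
-- Tot f − 2(q+1) = G(pro f) − G(f) for the total potential G, and the right-hand sides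
-- telescope along an orbit.

module Submission where

open import Defs
open import Data.Nat.Base
  using (ℕ; zero; suc; _+_; _*_; _∸_; _≤_; _<_; _≤‴_; _≡ᵇ_; _≤ᵇ_; z≤n; s≤s; z<s;
         ≤‴-refl; ≤‴-step)
open import Data.Nat.Properties
  using (_≟_; _≤?_; ≤-refl; ≤-trans; <⇒≤; >⇒≢; <⇒≱; ≰⇒>; <-trans; <-cmp; m≤n⇒m≤1+n;
         +-identityʳ; +-suc; +-comm; *-zeroʳ; +-cancelʳ-≡; +-∸-assoc; ≤⇒≤‴; ≤‴⇒≤)
open import Data.Nat.Tactic.RingSolver using (solve-∀)
open import Data.Bool.Base using (true; false; if_then_else_; _∧_)
open import Data.Bool.Properties using (∧-zeroʳ)
open import Data.Fin.Base using (Fin; zero; suc)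
open import Data.Maybe.Base using (Maybe; just; nothing)
open import Data.Vec.Base using (_∷_; []; map; lookup)
open import Data.Vec.Properties using (map-cong)
open import Data.List.Base using (List; _∷_; []; foldl; applyUpTo; upTo)
import Data.List.Base as List
open import Data.List.Properties using (map-upTo)
open import Data.Product.Base using (_×_; _,_; proj₁; proj₂)
open import Function.Base using (_∘_)
open import Relation.Binary.Definitions using (tri<; tri≈; tri>)
open import Relation.Binary.PropositionalEquality
  using (_≡_; _≢_; refl; sym; trans; cong; cong₂; subst; subst₂; module ≡-Reasoning)
open import Relation.Nullary.Decidable using (yes; no; dec-true; dec-false)
open ≡-Reasoning

≡ᵇ-refl : ∀ n → (n ≡ᵇ n) ≡ true
≡ᵇ-refl n = dec-true (n ≟ n) refl

≢⇒≡ᵇ-false : ∀ {m n} → m ≢ n → (m ≡ᵇ n) ≡ false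
≢⇒≡ᵇ-false {m} {n} = dec-false (m ≟ n)

≤⇒≤ᵇ-true : ∀ {m n} → m ≤ n → (m ≤ᵇ n) ≡ true
≤⇒≤ᵇ-true {m} {n} = dec-true (m ≤? n)

>⇒≤ᵇ-false : ∀ {m n} → n < m → (m ≤ᵇ n) ≡ false
>⇒≤ᵇ-false {m} {n} n<m = dec-false (m ≤? n) (<⇒≱ n<m)

-- Telescoping along orbits

-- A potential is kept as gain − loss to stay in ℕ, so that "a − c = G(pro f) − G(f)"
-- reads  a + gain f + loss (pro f) ≡ c + gain (pro f) + loss f.
module _ {q c : ℕ} (gain loss : Labeling → ℕ)
         (pro-Inc : ∀ {f} → Inc q f → Inc q (pro q f))
         (balance : ∀ {f} → Inc q f →
                    Tot f + gain f + loss (pro q f) ≡ c + gain (pro q f) + loss f)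
         where

  iter-Inc : ∀ {f} → Inc q f → ∀ n → Inc q (iter n (pro q) f)
  iter-Inc f-inc zero    = f-inc
  iter-Inc f-inc (suc n) = pro-Inc (iter-Inc f-inc n)

  orbitSum-balance : ∀ {f} → Inc q f → ∀ n →
    orbitSum q n f + gain f + loss (iter n (pro q) f) ≡ c * n + gain (iter n (pro q) f) + loss f
  orbitSum-balance {f} f-inc zero =
    cong (λ k → k + gain f + loss f) (sym (*-zeroʳ c))
  orbitSum-balance {f} f-inc (suc n) =
    +-cancelʳ-≡ (gain fₙ + loss fₙ) _ _ (begin
      (orbitSum q n f + Tot fₙ) + gain f + loss fₙ₊₁ + (gain fₙ + loss fₙ)
        ≡⟨ split (orbitSum q n f) (Tot fₙ) (gain f) (gain fₙ) (loss fₙ) (loss fₙ₊₁) ⟩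
      (orbitSum q n f + gain f + loss fₙ) + (Tot fₙ + gain fₙ + loss fₙ₊₁)
        ≡⟨ cong₂ _+_ (orbitSum-balance f-inc n) (balance (iter-Inc f-inc n)) ⟩
      (c * n + gain fₙ + loss f) + (c + gain fₙ₊₁ + loss fₙ)
        ≡⟨ join c n (gain f) (gain fₙ) (gain fₙ₊₁) (loss f) (loss fₙ) ⟩
      c * suc n + gain fₙ₊₁ + loss f + (gain fₙ + loss fₙ)  ∎)
    where
    fₙ fₙ₊₁ : Labeling
    fₙ   = iter n (pro q) f
    fₙ₊₁ = pro q fₙ
    split : ∀ s t g g′ l′ l″ → (s + t) + g + l″ + (g′ + l′) ≡ (s + g + l′) + (t + g′ + l″)
    split = solve-∀
    join : ∀ c n g g′ g″ l l′ → (c * n + g′ + l) + (c + g″ + l′) ≡ c * suc n + g″ + l + (g′ + l′)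
    join = solve-∀

  coboundary⇒mesic : Mesic q c
  coboundary⇒mesic f f-inc n (_ , periodic , _) =
    +-cancelʳ-≡ (gain f) _ _ (+-cancelʳ-≡ (loss f) _ _
      (subst (λ g → orbitSum q n f + gain f + loss g ≡ c * n + gain g + loss f)
             periodic (orbitSum-balance f-inc n)))

-- Potentials of matched pairs

Pair : Set
Pair = ℕ × ℕ

pairTotal : Pair → ℕ
pairTotal (u , v) = u + v

pairGain : ℕ → Pair → ℕ
pairGain q (u , v) = u * (q + v)

pairLoss : Pair → ℕ
pairLoss (u , v) = u * u + v * v

data PairStep (q : ℕ) : Pair → Pair → Set where
  shift     : ∀ {u v} → PairStep q (suc u , suc v) (u , v)
  wrap      : ∀ {u}   → PairStep q (suc u , 1) (q , u)
  wrap-tie  : ∀ {u}   → PairStep q (suc u , suc u) (q , u)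
  merge     : ∀ {u}   → PairStep q (suc u , 1) (u , u)
  wrap-both : PairStep q (1 , 1) (q , q)

pair-balance : ∀ {q p p′} → PairStep q p p′ →
  pairTotal p + pairGain q p + pairLoss p′ ≡ suc q + pairGain q p′ + pairLoss p
pair-balance {q} (shift {u} {v}) = shift-balance q u v
  where
  shift-balance : ∀ q u v →
    suc u + suc v + suc u * (q + suc v) + (u * u + v * v)
      ≡ suc q + u * (q + v) + (suc u * suc u + suc v * suc v)
  shift-balance = solve-∀
pair-balance {q} (wrap {u}) = wrap-balance q u
  where
  wrap-balance : ∀ q u →
    suc u + 1 + suc u * (q + 1) + (q * q + u * u)
      ≡ suc q + q * (q + u) + (suc u * suc u + 1 * 1)
  wrap-balance = solve-∀
pair-balance {q} (wrap-tie {u}) = wrap-tie-balance q u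
  where
  wrap-tie-balance : ∀ q u →
    suc u + suc u + suc u * (q + suc u) + (q * q + u * u)
      ≡ suc q + q * (q + u) + (suc u * suc u + suc u * suc u)
  wrap-tie-balance = solve-∀
pair-balance {q} (merge {u}) = merge-balance q u
  where
  merge-balance : ∀ q u →
    suc u + 1 + suc u * (q + 1) + (u * u + u * u)
      ≡ suc q + u * (q + u) + (suc u * suc u + 1 * 1)
  merge-balance = solve-∀
pair-balance {q} wrap-both = wrap-both-balance q
  where
  wrap-both-balance : ∀ q →
    1 + 1 + 1 * (q + 1) + (q * q + q * q) ≡ suc q + q * (q + q) + (1 * 1 + 1 * 1)
  wrap-both-balance = solve-∀

Matching : Set
Matching = Pair × Pair

matching : Labeling → Matching
matching (a ∷ b ∷ c ∷ d ∷ []) =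
  if (c ≤ᵇ a) ∧ (d ≤ᵇ b) then ((a , c) , (b , d)) else ((b , c) , (d , a))

total : Matching → ℕ
total (p₁ , p₂) = pairTotal p₁ + pairTotal p₂

gain : ℕ → Matching → ℕ
gain q (p₁ , p₂) = pairGain q p₁ + pairGain q p₂

loss : Matching → ℕ
loss (p₁ , p₂) = pairLoss p₁ + pairLoss p₂

matching-vertical : ∀ {a b c d} → c ≤ a → d ≤ b →
  matching (a ∷ b ∷ c ∷ d ∷ []) ≡ ((a , c) , (b , d))
matching-vertical c≤a d≤b rewrite ≤⇒≤ᵇ-true c≤a | ≤⇒≤ᵇ-true d≤b = refl

matching-crossedˡ : ∀ {a b c d} → a < c → matching (a ∷ b ∷ c ∷ d ∷ []) ≡ ((b , c) , (d , a))
matching-crossedˡ a<c rewrite >⇒≤ᵇ-false a<c = refl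

matching-crossedʳ : ∀ {a b c d} → b < d → matching (a ∷ b ∷ c ∷ d ∷ []) ≡ ((b , c) , (d , a))
matching-crossedʳ {a} {c = c} b<d rewrite >⇒≤ᵇ-false b<d | ∧-zeroʳ (c ≤ᵇ a) = refl

Tot≡total-matching : ∀ f → Tot f ≡ total (matching f)
Tot≡total-matching (a ∷ b ∷ c ∷ d ∷ []) with (c ≤ᵇ a) ∧ (d ≤ᵇ b)
... | true  = vertical a b c d
  where
  vertical : ∀ a b c d → a + (b + (c + (d + 0))) ≡ (a + c) + (b + d)
  vertical = solve-∀
... | false = crossed a b c d
  where
  crossed : ∀ a b c d → a + (b + (c + (d + 0))) ≡ (b + c) + (d + a)
  crossed = solve-∀

data MatchingStep (q : ℕ) : Matching → Matching → Set where
  straight : ∀ {p₁ p₂ p₁′ p₂′} → PairStep q p₁ p₁′ → PairStep q p₂ p₂′ →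
             MatchingStep q (p₁ , p₂) (p₁′ , p₂′)
  swapped  : ∀ {p₁ p₂ p₁′ p₂′} → PairStep q p₁ p₂′ → PairStep q p₂ p₁′ →
             MatchingStep q (p₁ , p₂) (p₁′ , p₂′)

straight-balance : ∀ {q p₁ p₂ p₁′ p₂′} → PairStep q p₁ p₁′ → PairStep q p₂ p₂′ →
  total (p₁ , p₂) + gain q (p₁ , p₂) + loss (p₁′ , p₂′)
    ≡ 2 * suc q + gain q (p₁′ , p₂′) + loss (p₁ , p₂)
straight-balance {q} {p₁} {p₂} {p₁′} {p₂′} s₁ s₂ = begin
  (T₁ + T₂) + (G₁ + G₂) + (L₁′ + L₂′)      ≡⟨ interchange T₁ G₁ L₁′ T₂ G₂ L₂′ ⟨
  (T₁ + G₁ + L₁′) + (T₂ + G₂ + L₂′)        ≡⟨ cong₂ _+_ (pair-balance s₁) (pair-balance s₂) ⟩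
  (suc q + G₁′ + L₁) + (suc q + G₂′ + L₂)  ≡⟨ double (suc q) G₁′ L₁ G₂′ L₂ ⟩
  2 * suc q + (G₁′ + G₂′) + (L₁ + L₂)      ∎
  where
  T₁ T₂ G₁ G₂ G₁′ G₂′ L₁ L₂ L₁′ L₂′ : ℕ
  T₁ = pairTotal p₁
  T₂ = pairTotal p₂
  G₁ = pairGain q p₁
  G₂ = pairGain q p₂
  G₁′ = pairGain q p₁′
  G₂′ = pairGain q p₂′
  L₁ = pairLoss p₁
  L₂ = pairLoss p₂
  L₁′ = pairLoss p₁′
  L₂′ = pairLoss p₂′
  interchange : ∀ a b c a′ b′ c′ → (a + b + c) + (a′ + b′ + c′) ≡ (a + a′) + (b + b′) + (c + c′)
  interchange = solve-∀
  double : ∀ k b c b′ c′ → (k + b + c) + (k + b′ + c′) ≡ 2 * k + (b + b′) + (c + c′)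
  double = solve-∀

matching-balance : ∀ {q M M′} → MatchingStep q M M′ →
  total M + gain q M + loss M′ ≡ 2 * suc q + gain q M′ + loss M
matching-balance (straight s₁ s₂) = straight-balance s₁ s₂
matching-balance {q} {M} (swapped {p₁′ = p₁′} {p₂′} s₁ s₂) =
  subst₂ (λ g l → total M + gain q M + l ≡ 2 * suc q + g + loss M)
         (+-comm (pairGain q p₂′) (pairGain q p₁′)) (+-comm (pairLoss p₂′) (pairLoss p₁′))
         (straight-balance s₁ s₂)

matching-shift : ∀ {q} a b c d →
  MatchingStep q (matching (suc a ∷ suc b ∷ suc c ∷ suc d ∷ [])) (matching (a ∷ b ∷ c ∷ d ∷ []))
matching-shift {q} a b c d with c ≤? a | d ≤? b
... | yes c≤a | yes d≤b =
  subst₂ (MatchingStep q) (sym (matching-vertical (s≤s c≤a) (s≤s d≤b)))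
    (sym (matching-vertical c≤a d≤b))
    (straight shift shift)
... | no c≰a | _ =
  subst₂ (MatchingStep q) (sym (matching-crossedˡ {b = suc b} {d = suc d} (s≤s (≰⇒> c≰a))))
    (sym (matching-crossedˡ {b = b} {d = d} (≰⇒> c≰a)))
    (straight shift shift)
... | yes _ | no d≰b =
  subst₂ (MatchingStep q) (sym (matching-crossedʳ {suc a} {c = suc c} (s≤s (≰⇒> d≰b))))
    (sym (matching-crossedʳ {a} {c = c} (≰⇒> d≰b)))
    (straight shift shift)

-- Promotion on Z₄, slide by slide

slides : State → List ℕ → State
slides = foldl (λ s i → slide i s)

labels : ℕ → ℕ → List ℕ
labels lo zero    = []
labels lo (suc n) = lo ∷ labels (suc lo) n

-- lo, lo + 1, …, hi − 1
interval : ℕ → ℕ → List ℕ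
interval lo hi = labels lo (hi ∸ lo)

interval-∷ : ∀ {lo hi} → lo < hi → interval lo hi ≡ lo ∷ interval (suc lo) hi
interval-∷ {lo} (s≤s lo≤hi) = cong (labels lo) (+-∸-assoc 1 lo≤hi)

applyUpTo≡labels : ∀ {f : ℕ → ℕ} lo n → (∀ i → f i ≡ lo + i) → applyUpTo f n ≡ labels lo n
applyUpTo≡labels lo zero    _   = refl
applyUpTo≡labels lo (suc n) f≗ =
  cong₂ _∷_ (trans (f≗ 0) (+-identityʳ lo))
            (applyUpTo≡labels (suc lo) n (λ i → trans (f≗ (suc i)) (+-suc lo i)))

slides-idle : ∀ {s} L → (∀ i → slide i s ≡ s) → slides s L ≡ s
slides-idle []      _      = refl
slides-idle (i ∷ L) stable = trans (cong (λ t → slides t L) (stable i)) (slides-idle L stable)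

slides-first-move : ∀ {s t lo m hi} → lo ≤ m → m < hi →
  (∀ {i} → i < m → slide i s ≡ s) → slide m s ≡ t →
  slides s (interval lo hi) ≡ slides t (interval (suc m) hi)
slides-first-move {s} {t} {lo} {m} {hi} lo≤m m<hi idle moved = go (≤⇒≤‴ lo≤m)
  where
  go : ∀ {lo} → lo ≤‴ m → slides s (interval lo hi) ≡ slides t (interval (suc m) hi)
  go ≤‴-refl = begin
    slides s (interval m hi)
      ≡⟨ cong (slides s) (interval-∷ m<hi) ⟩
    slides (slide m s) (interval (suc m) hi)
      ≡⟨ cong (λ u → slides u (interval (suc m) hi)) moved ⟩
    slides t (interval (suc m) hi)  ∎
  go {lo} (≤‴-step lo<m) = begin
    slides s (interval lo hi)
      ≡⟨ cong (slides s) (interval-∷ (<-trans (≤‴⇒≤ lo<m) m<hi)) ⟩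
    slides (slide lo s) (interval (suc lo) hi)
      ≡⟨ cong (λ u → slides u (interval (suc lo) hi)) (idle (≤‴⇒≤ lo<m)) ⟩
    slides s (interval (suc lo) hi)
      ≡⟨ go lo<m ⟩
    slides t (interval (suc m) hi)  ∎

slides-move : ∀ {s t lo m hi} → lo ≤ m → m < hi →
  (∀ {i} → i < m → slide i s ≡ s) → slide m s ≡ t → (∀ i → slide i t ≡ t) →
  slides s (interval lo hi) ≡ t
slides-move {m = m} {hi} lo≤m m<hi idle moved stable =
  trans (slides-first-move lo≤m m<hi idle moved) (slides-idle (interval (suc m) hi) stable)

markOnes : Labeling → State
markOnes = map (λ a → if a ≡ᵇ 1 then nothing else just a)

unmark : ℕ → Maybe ℕ → ℕ
unmark q nothing  = q
unmark q (just a) = a ∸ 1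

pro-via-slides : ∀ q f {t} → slides (markOnes f) (interval 2 (suc q)) ≡ t →
  pro q f ≡ map (unmark q) t
pro-via-slides q f refl = begin
  pro q f
    ≡⟨ map-cong (λ { nothing → refl ; (just _) → refl }) _ ⟩
  map (unmark q) (slides (markOnes f) (List.map (2 +_) (upTo (q ∸ 1))))
    ≡⟨ cong (λ L → map (unmark q) (slides (markOnes f) L))
            (trans (map-upTo (2 +_) (q ∸ 1)) (applyUpTo≡labels 2 (q ∸ 1) (λ _ → refl))) ⟩
  map (unmark q) (slides (markOnes f) (interval 2 (suc q)))  ∎

□ : Maybe ℕ
□ = nothing

-- slide-boxₛ is about a state whose empty boxes sit exactly at the elements xₛ, and
-- -toₜ says where they sit after the slide.

slide-box₂ : ∀ a c d i →
  slide i (just a ∷ □ ∷ just c ∷ just d ∷ []) ≡ (just a ∷ □ ∷ just c ∷ just d ∷ [])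
slide-box₂ a c d i rewrite ∧-zeroʳ (a ≡ᵇ i) | ∧-zeroʳ (c ≡ᵇ i) | ∧-zeroʳ (d ≡ᵇ i) = refl

slide-box₄ : ∀ a b c i →
  slide i (just a ∷ just b ∷ just c ∷ □ ∷ []) ≡ (just a ∷ just b ∷ just c ∷ □ ∷ [])
slide-box₄ a b c i rewrite ∧-zeroʳ (a ≡ᵇ i) | ∧-zeroʳ (b ≡ᵇ i) | ∧-zeroʳ (c ≡ᵇ i) = refl

slide-box₂₄ : ∀ a c i → slide i (just a ∷ □ ∷ just c ∷ □ ∷ []) ≡ (just a ∷ □ ∷ just c ∷ □ ∷ [])
slide-box₂₄ a c i rewrite ∧-zeroʳ (a ≡ᵇ i) | ∧-zeroʳ (c ≡ᵇ i) = refl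

slide-no-box : ∀ a b c d i →
  slide i (just a ∷ just b ∷ just c ∷ just d ∷ []) ≡ (just a ∷ just b ∷ just c ∷ just d ∷ [])
slide-no-box a b c d i
  rewrite ∧-zeroʳ (a ≡ᵇ i) | ∧-zeroʳ (b ≡ᵇ i) | ∧-zeroʳ (c ≡ᵇ i) | ∧-zeroʳ (d ≡ᵇ i) = refl

slide-box₁-idle : ∀ b c d {i} → b ≢ i →
  slide i (□ ∷ just b ∷ just c ∷ just d ∷ []) ≡ (□ ∷ just b ∷ just c ∷ just d ∷ [])
slide-box₁-idle b c d {i} b≢i rewrite ≢⇒≡ᵇ-false b≢i | ∧-zeroʳ (c ≡ᵇ i) | ∧-zeroʳ (d ≡ᵇ i) = refl

slide-box₃-idle : ∀ a b d {i} → b ≢ i → d ≢ i →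
  slide i (just a ∷ just b ∷ □ ∷ just d ∷ []) ≡ (just a ∷ just b ∷ □ ∷ just d ∷ [])
slide-box₃-idle a b d {i} b≢i d≢i
  rewrite ≢⇒≡ᵇ-false b≢i | ≢⇒≡ᵇ-false d≢i | ∧-zeroʳ (a ≡ᵇ i) = refl

slide-box₁₃-idle : ∀ b d {i} → b ≢ i → d ≢ i →
  slide i (□ ∷ just b ∷ □ ∷ just d ∷ []) ≡ (□ ∷ just b ∷ □ ∷ just d ∷ [])
slide-box₁₃-idle b d b≢i d≢i rewrite ≢⇒≡ᵇ-false b≢i | ≢⇒≡ᵇ-false d≢i = refl

slide-box₁₄-idle : ∀ b c {i} → b ≢ i →
  slide i (□ ∷ just b ∷ just c ∷ □ ∷ []) ≡ (□ ∷ just b ∷ just c ∷ □ ∷ [])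
slide-box₁₄-idle b c {i} b≢i rewrite ≢⇒≡ᵇ-false b≢i | ∧-zeroʳ (c ≡ᵇ i) = refl

slide-box₁-to₂ : ∀ b c d →
  slide b (□ ∷ just b ∷ just c ∷ just d ∷ []) ≡ (just b ∷ □ ∷ just c ∷ just d ∷ [])
slide-box₁-to₂ b c d rewrite ≡ᵇ-refl b | ∧-zeroʳ (c ≡ᵇ b) | ∧-zeroʳ (d ≡ᵇ b) = refl

slide-box₁₄-to₂₄ : ∀ b c → slide b (□ ∷ just b ∷ just c ∷ □ ∷ []) ≡ (just b ∷ □ ∷ just c ∷ □ ∷ [])
slide-box₁₄-to₂₄ b c rewrite ≡ᵇ-refl b | ∧-zeroʳ (c ≡ᵇ b) = refl

slide-box₃-to₂ : ∀ a b d → d ≢ b →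
  slide b (just a ∷ just b ∷ □ ∷ just d ∷ []) ≡ (just a ∷ □ ∷ just b ∷ just d ∷ [])
slide-box₃-to₂ a b d d≢b rewrite ≡ᵇ-refl b | ≢⇒≡ᵇ-false d≢b | ∧-zeroʳ (a ≡ᵇ b) = refl

slide-box₃-to₄ : ∀ a b d → b ≢ d →
  slide d (just a ∷ just b ∷ □ ∷ just d ∷ []) ≡ (just a ∷ just b ∷ just d ∷ □ ∷ [])
slide-box₃-to₄ a b d b≢d rewrite ≡ᵇ-refl d | ≢⇒≡ᵇ-false b≢d | ∧-zeroʳ (a ≡ᵇ d) = refl

slide-box₃-to₂₄ : ∀ a b →
  slide b (just a ∷ just b ∷ □ ∷ just b ∷ []) ≡ (just a ∷ □ ∷ just b ∷ □ ∷ [])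
slide-box₃-to₂₄ a b rewrite ≡ᵇ-refl b | ∧-zeroʳ (a ≡ᵇ b) = refl

slide-box₁₃-to₂ : ∀ b d → d ≢ b →
  slide b (□ ∷ just b ∷ □ ∷ just d ∷ []) ≡ (just b ∷ □ ∷ just b ∷ just d ∷ [])
slide-box₁₃-to₂ b d d≢b rewrite ≡ᵇ-refl b | ≢⇒≡ᵇ-false d≢b = refl

slide-box₁₃-to₁₄ : ∀ b d → b ≢ d →
  slide d (□ ∷ just b ∷ □ ∷ just d ∷ []) ≡ (□ ∷ just b ∷ just d ∷ □ ∷ [])
slide-box₁₃-to₁₄ b d b≢d rewrite ≡ᵇ-refl d | ≢⇒≡ᵇ-false b≢d = refl

slide-box₁₃-to₂₄ : ∀ b → slide b (□ ∷ just b ∷ □ ∷ just b ∷ []) ≡ (just b ∷ □ ∷ just b ∷ □ ∷ [])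
slide-box₁₃-to₂₄ b rewrite ≡ᵇ-refl b = refl

2≤2+ : ∀ n → 2 ≤ 2 + n
2≤2+ n = s≤s (s≤s z≤n)

below-top : ∀ {m q} → m ≤ q → 2 + m < 3 + q
below-top m≤q = s≤s (s≤s (s≤s m≤q))

pro-no-one : ∀ {q a b c d} →
  pro (2 + q) (2 + a ∷ 2 + b ∷ 2 + c ∷ 2 + d ∷ []) ≡ (1 + a ∷ 1 + b ∷ 1 + c ∷ 1 + d ∷ [])
pro-no-one {q} {a} {b} {c} {d} = pro-via-slides (2 + q) (2 + a ∷ 2 + b ∷ 2 + c ∷ 2 + d ∷ [])
  (slides-idle (interval 2 (3 + q)) (slide-no-box (2 + a) (2 + b) (2 + c) (2 + d)))

pro-one-at-x₁ : ∀ {q b c d} → b ≤ q →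
  pro (2 + q) (1 ∷ 2 + b ∷ 2 + c ∷ 2 + d ∷ []) ≡ (1 + b ∷ 2 + q ∷ 1 + c ∷ 1 + d ∷ [])
pro-one-at-x₁ {q} {b} {c} {d} b≤q = pro-via-slides (2 + q) (1 ∷ 2 + b ∷ 2 + c ∷ 2 + d ∷ [])
  (slides-move (2≤2+ b) (below-top b≤q)
    (λ i<b → slide-box₁-idle (2 + b) (2 + c) (2 + d) (>⇒≢ i<b))
    (slide-box₁-to₂ (2 + b) (2 + c) (2 + d))
    (slide-box₂ (2 + b) (2 + c) (2 + d)))

pro-one-at-x₃-b<d : ∀ {q a b d} → b < d → b ≤ q →
  pro (2 + q) (2 + a ∷ 2 + b ∷ 1 ∷ 2 + d ∷ []) ≡ (1 + a ∷ 2 + q ∷ 1 + b ∷ 1 + d ∷ [])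
pro-one-at-x₃-b<d {q} {a} {b} {d} b<d b≤q = pro-via-slides (2 + q) (2 + a ∷ 2 + b ∷ 1 ∷ 2 + d ∷ [])
  (slides-move (2≤2+ b) (below-top b≤q)
    (λ i<b → slide-box₃-idle (2 + a) (2 + b) (2 + d) (>⇒≢ i<b) (>⇒≢ (<-trans i<b (s≤s (s≤s b<d)))))
    (slide-box₃-to₂ (2 + a) (2 + b) (2 + d) (>⇒≢ (s≤s (s≤s b<d))))
    (slide-box₂ (2 + a) (2 + b) (2 + d)))

pro-one-at-x₃-b≡d : ∀ {q a b} → b ≤ q →
  pro (2 + q) (2 + a ∷ 2 + b ∷ 1 ∷ 2 + b ∷ []) ≡ (1 + a ∷ 2 + q ∷ 1 + b ∷ 2 + q ∷ [])
pro-one-at-x₃-b≡d {q} {a} {b} b≤q = pro-via-slides (2 + q) (2 + a ∷ 2 + b ∷ 1 ∷ 2 + b ∷ [])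
  (slides-move (2≤2+ b) (below-top b≤q)
    (λ i<b → slide-box₃-idle (2 + a) (2 + b) (2 + b) (>⇒≢ i<b) (>⇒≢ i<b))
    (slide-box₃-to₂₄ (2 + a) (2 + b))
    (slide-box₂₄ (2 + a) (2 + b)))

pro-one-at-x₃-d<b : ∀ {q a b d} → d < b → d ≤ q →
  pro (2 + q) (2 + a ∷ 2 + b ∷ 1 ∷ 2 + d ∷ []) ≡ (1 + a ∷ 1 + b ∷ 1 + d ∷ 2 + q ∷ [])
pro-one-at-x₃-d<b {q} {a} {b} {d} d<b d≤q = pro-via-slides (2 + q) (2 + a ∷ 2 + b ∷ 1 ∷ 2 + d ∷ [])
  (slides-move (2≤2+ d) (below-top d≤q)
    (λ i<d → slide-box₃-idle (2 + a) (2 + b) (2 + d) (>⇒≢ (<-trans i<d (s≤s (s≤s d<b)))) (>⇒≢ i<d))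
    (slide-box₃-to₄ (2 + a) (2 + b) (2 + d) (>⇒≢ (s≤s (s≤s d<b))))
    (slide-box₄ (2 + a) (2 + b) (2 + d)))

pro-ones-at-x₁x₃-b<d : ∀ {q b d} → b < d → b ≤ q →
  pro (2 + q) (1 ∷ 2 + b ∷ 1 ∷ 2 + d ∷ []) ≡ (1 + b ∷ 2 + q ∷ 1 + b ∷ 1 + d ∷ [])
pro-ones-at-x₁x₃-b<d {q} {b} {d} b<d b≤q = pro-via-slides (2 + q) (1 ∷ 2 + b ∷ 1 ∷ 2 + d ∷ [])
  (slides-move (2≤2+ b) (below-top b≤q)
    (λ i<b → slide-box₁₃-idle (2 + b) (2 + d) (>⇒≢ i<b) (>⇒≢ (<-trans i<b (s≤s (s≤s b<d)))))
    (slide-box₁₃-to₂ (2 + b) (2 + d) (>⇒≢ (s≤s (s≤s b<d))))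
    (slide-box₂ (2 + b) (2 + b) (2 + d)))

pro-ones-at-x₁x₃-b≡d : ∀ {q b} → b ≤ q →
  pro (2 + q) (1 ∷ 2 + b ∷ 1 ∷ 2 + b ∷ []) ≡ (1 + b ∷ 2 + q ∷ 1 + b ∷ 2 + q ∷ [])
pro-ones-at-x₁x₃-b≡d {q} {b} b≤q = pro-via-slides (2 + q) (1 ∷ 2 + b ∷ 1 ∷ 2 + b ∷ [])
  (slides-move (2≤2+ b) (below-top b≤q)
    (λ i<b → slide-box₁₃-idle (2 + b) (2 + b) (>⇒≢ i<b) (>⇒≢ i<b))
    (slide-box₁₃-to₂₄ (2 + b))
    (slide-box₂₄ (2 + b) (2 + b)))

pro-ones-at-x₁x₃-d<b : ∀ {q b d} → d < b → b ≤ q →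
  pro (2 + q) (1 ∷ 2 + b ∷ 1 ∷ 2 + d ∷ []) ≡ (1 + b ∷ 2 + q ∷ 1 + d ∷ 2 + q ∷ [])
pro-ones-at-x₁x₃-d<b {q} {b} {d} d<b b≤q =
  pro-via-slides (2 + q) (1 ∷ 2 + b ∷ 1 ∷ 2 + d ∷ []) (begin
    slides (□ ∷ just (2 + b) ∷ □ ∷ just (2 + d) ∷ []) (interval 2 (3 + q))
      ≡⟨ slides-first-move (2≤2+ d) (below-top (≤-trans (<⇒≤ d<b) b≤q))
           (λ i<d → slide-box₁₃-idle (2 + b) (2 + d) (>⇒≢ (<-trans i<d (s≤s (s≤s d<b)))) (>⇒≢ i<d))
           (slide-box₁₃-to₁₄ (2 + b) (2 + d) (>⇒≢ (s≤s (s≤s d<b)))) ⟩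
    slides (□ ∷ just (2 + b) ∷ just (2 + d) ∷ □ ∷ []) (interval (3 + d) (3 + q))
      ≡⟨ slides-move (s≤s (s≤s d<b)) (below-top b≤q)
           (λ i<b → slide-box₁₄-idle (2 + b) (2 + d) (>⇒≢ i<b))
           (slide-box₁₄-to₂₄ (2 + b) (2 + d))
           (slide-box₂₄ (2 + b) (2 + d)) ⟩
    (just (2 + b) ∷ □ ∷ just (2 + d) ∷ □ ∷ [])  ∎)

-- One promotion step

x₁ x₂ x₃ x₄ : Fin 4
x₁ = zero
x₂ = suc zero
x₃ = suc (suc zero)
x₄ = suc (suc (suc zero))

inc : ∀ {q a b c d} → 1 ≤ a → 1 ≤ c → a < b → c < b → c < d → b ≤ q → d ≤ q →
  Inc q (a ∷ b ∷ c ∷ d ∷ [])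
inc {q} {a} {b} {c} {d} 1≤a 1≤c a<b c<b c<d b≤q d≤q =
  record { inRange = inRange ; increasing = increasing }
  where
  f : Labeling
  f = a ∷ b ∷ c ∷ d ∷ []
  inRange : ∀ x → 1 ≤ lookup f x × lookup f x ≤ q
  inRange zero                   = 1≤a , ≤-trans (<⇒≤ a<b) b≤q
  inRange (suc zero)             = ≤-trans 1≤a (<⇒≤ a<b) , b≤q
  inRange (suc (suc zero))       = 1≤c , ≤-trans (<⇒≤ c<b) b≤q
  inRange (suc (suc (suc zero))) = ≤-trans 1≤c (<⇒≤ c<d) , d≤q
  increasing : ∀ x y → x <Z y → lookup f x < lookup f y
  increasing zero             (suc zero)             _ = a<b
  increasing (suc (suc zero)) (suc zero)             _ = c<b
  increasing (suc (suc zero)) (suc (suc (suc zero))) _ = c<d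
  increasing zero                   zero             ()
  increasing zero                   (suc (suc _))    ()
  increasing (suc zero)             _                ()
  increasing (suc (suc zero))       zero             ()
  increasing (suc (suc zero))       (suc (suc zero)) ()
  increasing (suc (suc (suc zero))) _                ()

record PromotionStep (q : ℕ) (f : Labeling) : Set where
  field
    pro-Inc       : Inc q (pro q f)
    matching-step : MatchingStep q (matching f) (matching (pro q f))
open PromotionStep

promoted : ∀ {q f g M M′} → pro q f ≡ g → Inc q g → matching f ≡ M → matching g ≡ M′ →
  MatchingStep q M M′ → PromotionStep q f
promoted refl g-inc refl refl step = record { pro-Inc = g-inc ; matching-step = step }

step-one-at-x₃ : ∀ {q a b d} → a < b → b ≤ q → d ≤ q →
  PromotionStep (2 + q) (2 + a ∷ 2 + b ∷ 1 ∷ 2 + d ∷ [])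
step-one-at-x₃ {b = b} {d} a<b b≤q d≤q with <-cmp b d
... | tri< b<d _ _ =
  promoted (pro-one-at-x₃-b<d b<d b≤q)
    (inc z<s z<s (s≤s (s≤s (≤-trans (<⇒≤ a<b) b≤q))) (s≤s (s≤s b≤q)) (s≤s b<d) ≤-refl
         (s≤s (m≤n⇒m≤1+n d≤q)))
    (matching-crossedʳ (s≤s (s≤s b<d)))
    (matching-crossedˡ (s≤s a<b))
    (straight wrap shift)
... | tri≈ _ refl _ =
  promoted (pro-one-at-x₃-b≡d b≤q)
    (inc z<s z<s (s≤s (s≤s (≤-trans (<⇒≤ a<b) b≤q))) (s≤s (s≤s b≤q)) (s≤s (s≤s b≤q))
         ≤-refl ≤-refl)
    (matching-vertical z<s ≤-refl)
    (matching-crossedˡ (s≤s a<b))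
    (swapped wrap wrap-tie)
... | tri> _ _ d<b =
  promoted (pro-one-at-x₃-d<b d<b d≤q)
    (inc z<s z<s (s≤s a<b) (s≤s d<b) (s≤s (s≤s d≤q)) (s≤s (m≤n⇒m≤1+n b≤q)) ≤-refl)
    (matching-vertical z<s (s≤s (s≤s (<⇒≤ d<b))))
    (matching-crossedʳ (s≤s (s≤s b≤q)))
    (swapped wrap shift)

step-ones-at-x₁x₃ : ∀ {q b d} → b ≤ q → d ≤ q →
  PromotionStep (2 + q) (1 ∷ 2 + b ∷ 1 ∷ 2 + d ∷ [])
step-ones-at-x₁x₃ {b = b} {d} b≤q d≤q with <-cmp b d
... | tri< b<d _ _ =
  promoted (pro-ones-at-x₁x₃-b<d b<d b≤q)
    (inc z<s z<s (s≤s (s≤s b≤q)) (s≤s (s≤s b≤q)) (s≤s b<d) ≤-refl (s≤s (m≤n⇒m≤1+n d≤q)))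
    (matching-crossedʳ (s≤s (s≤s b<d)))
    (matching-vertical ≤-refl (s≤s (m≤n⇒m≤1+n d≤q)))
    (straight merge wrap)
... | tri≈ _ refl _ =
  promoted (pro-ones-at-x₁x₃-b≡d b≤q)
    (inc z<s z<s (s≤s (s≤s b≤q)) (s≤s (s≤s b≤q)) (s≤s (s≤s b≤q)) ≤-refl ≤-refl)
    (matching-vertical ≤-refl ≤-refl)
    (matching-vertical ≤-refl ≤-refl)
    (swapped wrap-both shift)
... | tri> _ _ d<b =
  promoted (pro-ones-at-x₁x₃-d<b d<b b≤q)
    (inc z<s z<s (s≤s (s≤s b≤q)) (s≤s (s≤s d≤q)) (s≤s (s≤s d≤q)) ≤-refl ≤-refl)
    (matching-vertical ≤-refl (s≤s (s≤s (<⇒≤ d<b))))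
    (matching-vertical (s≤s (<⇒≤ d<b)) ≤-refl)
    (swapped wrap-both shift)

promotion-step′ : ∀ {q a b c d} → 1 ≤ a → 1 ≤ c → a < b → c < b → c < d → b ≤ q → d ≤ q →
  PromotionStep q (a ∷ b ∷ c ∷ d ∷ [])
promotion-step′ {suc (suc q)} {suc (suc a)} {suc (suc b)} {suc (suc c)} {suc (suc d)}
  _ _ (s≤s (s≤s a<b)) (s≤s (s≤s c<b)) (s≤s (s≤s c<d)) (s≤s (s≤s b≤q)) (s≤s (s≤s d≤q)) =
  promoted pro-no-one
    (inc z<s z<s (s≤s a<b) (s≤s c<b) (s≤s c<d) (s≤s (m≤n⇒m≤1+n b≤q)) (s≤s (m≤n⇒m≤1+n d≤q)))
    refl refl (matching-shift (1 + a) (1 + b) (1 + c) (1 + d))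
promotion-step′ {suc (suc q)} {1} {suc (suc b)} {suc (suc c)} {suc (suc d)}
  _ _ _ (s≤s (s≤s c<b)) (s≤s (s≤s c<d)) (s≤s (s≤s b≤q)) (s≤s (s≤s d≤q)) =
  promoted (pro-one-at-x₁ b≤q)
    (inc z<s z<s (s≤s (s≤s b≤q)) (s≤s (s≤s (≤-trans (<⇒≤ c<b) b≤q))) (s≤s c<d) ≤-refl
         (s≤s (m≤n⇒m≤1+n d≤q)))
    (matching-crossedˡ (s≤s z<s))
    (matching-vertical (s≤s (<⇒≤ c<b)) (s≤s (m≤n⇒m≤1+n d≤q)))
    (straight shift wrap)
promotion-step′ {suc (suc q)} {suc (suc a)} {suc (suc b)} {1} {suc (suc d)}
  _ _ (s≤s (s≤s a<b)) _ (s≤s (s≤s _)) (s≤s (s≤s b≤q)) (s≤s (s≤s d≤q)) =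
  step-one-at-x₃ a<b b≤q d≤q
promotion-step′ {suc (suc q)} {1} {suc (suc b)} {1} {suc (suc d)}
  _ _ (s≤s (s≤s _)) _ (s≤s (s≤s _)) (s≤s (s≤s b≤q)) (s≤s (s≤s d≤q)) =
  step-ones-at-x₁x₃ b≤q d≤q

promotion-step : ∀ {q f} → Inc q f → PromotionStep q f
promotion-step {f = a ∷ b ∷ c ∷ d ∷ []} f-inc =
  promotion-step′ (proj₁ (inRange x₁)) (proj₁ (inRange x₃))
    (increasing x₁ x₂ refl) (increasing x₃ x₂ refl) (increasing x₃ x₄ refl)
    (proj₂ (inRange x₂)) (proj₂ (inRange x₄))
  where open Inc f-inc

corollary7p12 : ∀ (q : ℕ) → Mesic q (2 * suc q)
corollary7p12 q =
  coboundary⇒mesic {c = 2 * suc q} (gain q ∘ matching) (loss ∘ matching)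
    (pro-Inc ∘ promotion-step) balance
  where
  balance : ∀ {f} → Inc q f →
    Tot f + gain q (matching f) + loss (matching (pro q f))
      ≡ 2 * suc q + gain q (matching (pro q f)) + loss (matching f)
  balance {f} f-inc =
    begin
      Tot f + gain q (matching f) + loss (matching (pro q f))
        ≡⟨ cong (λ t → t + gain q (matching f) + loss (matching (pro q f)))
                (Tot≡total-matching f) ⟩
      total (matching f) + gain q (matching f) + loss (matching (pro q f))
        ≡⟨ matching-balance (matching-step (promotion-step f-inc)) ⟩
      2 * suc q + gain q (matching (pro q f)) + loss (matching f)  ∎
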